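{- Let $p=(12,\{(0,0),(0,1),(0,2),(1,0),(1,2),(2,0),(2,1)\})$. A permutation $\pi\in S_n$ contains $p$ if and only if $\pi_1=1$ and the permutation of length $n-1$ obtained from $\pi_2\cdots\pi_n$ by subtracting $1$ from each letter has a strong fixed point. Consequently, for $n\ge1$, \[|S_n(p)| = n!-(n-1)!+[x^{n-1}]\frac{F(x)}{1+xF(x)},\qquad F(x)=\sum_{m\ge0}m!\,x^m.\]
   Context: $S_n$ is the set of permutations of $\{1,\dots,n\}$, written $\pi=\pi_1\cdots\pi_n$. A strong fixed point of $\sigma$ is an index $k$ such that $\sigma_j<\sigma_k$ for all $j<k$ and $\sigma_j>\sigma_k$ for all $j>k$. A mesh pattern $(12,R)$ of length 2 has $R\subseteq\{0,1,2\}^2$ (shaded boxes). A permutation $\pi\in S_n$ contains $(12,R)$ if there exist indices $i<j$ with $\pi_i<\pi_j$ such that, with $p_0=0,p_1=i,p_2=j,p_3=n+1$ and $v_0=0,v_1=\pi_i,v_2=\pi_j,v_3=n+1$, for every $(a,b)\in R$ there is no index $x$ with $p_a<x<p_{a+1}$ and $v_b<\pi_x<v_{b+1}$. Otherwise $\pi$ avoids it; $S_n(p)$ is the set of avoiders in $S_n$. $[x^m]f(x)$ is the coefficient of $x^m$ in the power series $f$. -}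

module Defs where

open import Data.Nat using (ℕ; zero; suc; _+_; _∸_; _<_; _≤_)
open import Data.Nat using (_!)
open import Data.Integer as ℤ using (ℤ; +_)
open import Data.Fin using (Fin; toℕ)
import Data.Fin as Fin
open import Data.Vec using (Vec; lookup; map; tail)
open import Data.List using (List; []; _∷_; length; upTo; zip; _++_; [_])
import Data.List as List
open import Data.List.Membership.Propositional using (_∈_)
open import Data.List.Relation.Unary.All using (All)
open import Data.List.Relation.Unary.Unique.Propositional using (Unique)
open import Data.Product using (Σ; ∃; ∃-syntax; _×_; _,_)
open import Relation.Nullary using (¬_)
open import Relation.Binary.PropositionalEquality using (_≡_)

-- Permutations of {1,…,n} in one-line notation: π = π₁⋯πₙ is a vector
-- of naturals; position i : Fin n stands for the 1-based index toℕ i + 1.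

IsPerm : ∀ {n} → Vec ℕ n → Set
IsPerm {n} π =
  (∀ (i : Fin n) → 1 ≤ lookup π i × lookup π i ≤ n) ×
  (∀ (i j : Fin n) → lookup π i ≡ lookup π j → i ≡ j)

pos : ∀ {n} → Fin n → ℕ
pos i = suc (toℕ i)

Box : Set
Box = Fin 3 × Fin 3

-- the four boundaries p₀ < p₁ < p₂ < p₃ (resp. v₀ … v₃)
bound : ℕ → ℕ → ℕ → Fin 4 → ℕ
bound first second last Fin.zero = 0
bound first second last (Fin.suc Fin.zero) = first
bound first second last (Fin.suc (Fin.suc Fin.zero)) = second
bound first second last (Fin.suc (Fin.suc (Fin.suc Fin.zero))) = last

BoxEmpty : ∀ {n} → Vec ℕ n → Fin n → Fin n → Box → Set
BoxEmpty {n} π i j (a , b) =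
  ¬ (∃[ x ] (P (Fin.inject₁ a) < pos x × pos x < P (Fin.suc a) ×
             V (Fin.inject₁ b) < lookup π x × lookup π x < V (Fin.suc b)))
  where
    P = bound (pos i) (pos j) (suc n)
    V = bound (lookup π i) (lookup π j) (suc n)

Contains12 : List Box → ∀ {n} → Vec ℕ n → Set
Contains12 R {n} π =
  ∃[ i ] ∃[ j ] (toℕ i < toℕ j × lookup π i < lookup π j ×
                 (∀ {r} → r ∈ R → BoxEmpty π i j r))

R₀ : List Box
R₀ = (Fin.zero , Fin.zero) ∷ (Fin.zero , Fin.suc Fin.zero) ∷
     (Fin.zero , Fin.suc (Fin.suc Fin.zero)) ∷
     (Fin.suc Fin.zero , Fin.zero) ∷
     (Fin.suc Fin.zero , Fin.suc (Fin.suc Fin.zero)) ∷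
     (Fin.suc (Fin.suc Fin.zero) , Fin.zero) ∷
     (Fin.suc (Fin.suc Fin.zero) , Fin.suc Fin.zero) ∷ []

HasStrongFixedPoint : ∀ {n} → Vec ℕ n → Set
HasStrongFixedPoint {n} σ =
  ∃[ k ] ((∀ (j : Fin n) → toℕ j < toℕ k → lookup σ j < lookup σ k) ×
          (∀ (j : Fin n) → toℕ k < toℕ j → lookup σ k < lookup σ j))

NumAvoiders : List Box → ℕ → ℕ → Set
NumAvoiders R n N =
  Σ (List (Vec ℕ n)) λ L →
    Unique L ×
    All (λ π → IsPerm π × ¬ Contains12 R π) L ×
    (∀ (π : Vec ℕ n) → IsPerm π → ¬ Contains12 R π → π ∈ L) ×
    length L ≡ N

PS : Set
PS = ℕ → ℤ

sumℤ : List ℤ → ℤ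
sumℤ = List.foldr ℤ._+_ (+ 0)

-- Given f and h with h 0 = 1, the coefficients q of q = f / h are
-- determined by  q m = f m - Σ_{k<m} q k * h (m - k).
private
  nextCoeff : PS → PS → List ℤ → ℕ → ℤ
  nextCoeff f h qs m =
    f m ℤ.- sumℤ (List.map (λ { (k , q) → q ℤ.* h (m ∸ k) }) (zip (upTo m) qs))

  firstCoeffs : PS → PS → ℕ → List ℤ
  firstCoeffs f h zero = []
  firstCoeffs f h (suc m) = firstCoeffs f h m ++ [ nextCoeff f h (firstCoeffs f h m) m ]

divPS : PS → PS → PS
divPS f h m = nextCoeff f h (firstCoeffs f h m) m

F : PS
F m = + (m !)

onePlusXF : PS
onePlusXF zero = + 1
onePlusXF (suc m) = F m

G : PS
G = divPS F onePlusXF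

-- In an occurrence (i , j) of the pattern the first column and the bottom row are shaded, so i is
-- the first position and π_i = 1; the only unshaded boxes besides those are (1,1) and (2,2), so
-- every entry between positions i and j lies below π_j and every entry after j lies above it:
-- j is a strong fixed point of π₂⋯πₙ. Conversely such a permutation visibly contains the
-- pattern. So the permutations of length m + 1 containing the pattern correspond to the
-- permutations of length m with a strong fixed point. Cutting one of these at its first strong
-- fixed point k + 1 writes it uniquely as α, k + 1, β + (k + 1) with α a permutation of length k
-- without strong fixed point and β arbitrary. Writing a_k for the number of permutations of
-- length k without strong fixed point this gives m! = a_m + Σ_{k<m} a_k (m-1-k)!, that is
-- F = A (1 + x F), whence a_m = [x^m] F/(1 + x F) and there are (m+1)! - (m! - a_m) avoiders.

module Submission where

open import Defs
open import Data.Nat as ℕ using (ℕ; zero; suc; _+_; _*_; _∸_; _!; _≤_; _<_; z≤n; s≤s; _<?_)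
open import Data.Nat.Properties
open import Data.Nat.Induction using (<-wellFounded; <-rec)
open import Induction.WellFounded using (Acc; acc)
open import Data.List as List
  using (List; []; _∷_; _++_; [_]; _∷ʳ_; length; map; filter; upTo; applyUpTo; cartesianProduct; concatMap; zip)
open import Data.Nat.ListAction using (sum)
open import Data.List.Properties
  using (map-id; map-∘; map-++; map-cong; map-injective; map-applyUpTo; ++-assoc; ++-identityʳ; ∷-injective;
         ∷-injectiveˡ; ∷-injectiveʳ; length-map; length-++; length-filter; length-applyUpTo; filter-notAll;
         applyUpTo-∷ʳ; upTo-∷ʳ)
open import Data.List.Membership.Propositional using (_∈_; _∉_; find)
open import Data.List.Membership.Propositional.Properties
open import Data.List.Membership.Propositional.Properties.WithK using (unique∧set⇒bag)
open import Data.List.Relation.Binary.BagAndSetEquality using (∼bag⇒↭)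
open import Data.List.Relation.Binary.Permutation.Propositional
  using (_↭_; ↭-refl; ↭-sym; ↭-trans; ↭-reflexive; prep; ↭⇒↭ₛ; module PermutationReasoning)
import Data.List.Relation.Binary.Permutation.Setoid.Properties as PermutationSetoid
open import Data.List.Relation.Binary.Permutation.Propositional.Properties
  using (↭-length; drop-∷; drop-mid; shift; ∷↭∷ʳ; ∈-resp-↭; ↭-empty-inv; ++⁺; ++⁺ʳ; map⁺; ↭-map-inv)
open import Data.List.Relation.Binary.Subset.Propositional using (_⊆_)
open import Data.List.Relation.Unary.Any as Any using (here; there)
open import Data.List.Relation.Unary.All as All using (All; []; _∷_)
import Data.List.Relation.Unary.All.Properties as All
open import Data.List.Relation.Unary.Unique.Propositional using (Unique; []; _∷_)
import Data.List.Relation.Unary.Unique.Propositional.Properties as Unique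
open import Data.Integer as ℤ using (ℤ)
import Data.Integer.Properties as ℤ
open import Data.Integer.Solver using (module +-*-Solver)
open +-*-Solver using (solve; _:+_; _:-_; _:=_)
open import Data.Vec as Vec using (Vec; lookup; toList; fromList; _∷_)
open import Data.Vec.Properties using (toList∘fromList; length-toList; lookup-map; toList-map)
import Data.Vec.Membership.Propositional.Properties as Vec∈
import Data.Vec.Relation.Unary.Any as VAny using (index)
import Data.Vec.Relation.Unary.Any.Properties as VAnyProperties
import Data.Vec.Relation.Unary.All.Properties as VAll
open import Data.Fin using (Fin; zero; suc; toℕ; inject₁)
open import Data.Fin.Patterns using (0F; 1F; 2F)
import Data.Fin.Properties as Fin
open import Data.Fin.Properties using (any?; all?)
open import Data.Product using (Σ; ∃; ∃₂; ∃-syntax; _×_; _,_; proj₁; proj₂; uncurry)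
open import Data.Sum using (_⊎_; inj₁; inj₂)
open import Data.Empty using (⊥)
open import Function using (_∘_; _⇔_; mk⇔; Equivalence; case_of_)
open import Relation.Nullary using (¬_; Dec; yes; no; ¬?; contradiction; _×-dec_; _→-dec_)
import Relation.Nullary.Decidable as Dec
open import Relation.Unary using (Decidable)
open import Relation.Unary.Properties using (∁?)
open import Relation.Binary.Definitions using (DecidableEquality; tri<; tri≈; tri>)
open import Relation.Binary.PropositionalEquality hiding ([_])
open import Relation.Binary.PropositionalEquality.Properties using (setoid)

module _ {A : Set} where

  unique∧set⇒↭ : {xs ys : List A} → Unique xs → Unique ys → (∀ {z} → z ∈ xs ⇔ z ∈ ys) → xs ↭ ys
  unique∧set⇒↭ u v xs≈ys = ∼bag⇒↭ (unique∧set⇒bag u v xs≈ys)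

  module _ (_≟_ : DecidableEquality A) where

    open import Data.List.Membership.DecPropositional _≟_ using (_∈?_)

    unique-⊆⇒length≤ : {xs ys : List A} → Unique xs → Unique ys → xs ⊆ ys → length xs ≤ length ys
    unique-⊆⇒length≤ {xs} {ys} u v xs⊆ys = begin
      length xs                   ≡⟨ ↭-length (unique∧set⇒↭ u (Unique.filter⁺ (_∈? xs) v) (mk⇔ to from)) ⟩
      length (filter (_∈? xs) ys) ≤⟨ length-filter (_∈? xs) ys ⟩
      length ys                   ∎
      where
      open ≤-Reasoning
      to : ∀ {z} → z ∈ xs → z ∈ filter (_∈? xs) ys
      to z∈xs = ∈-filter⁺ (_∈? xs) (xs⊆ys z∈xs) z∈xs
      from : ∀ {z} → z ∈ filter (_∈? xs) ys → z ∈ xs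
      from = proj₂ ∘ ∈-filter⁻ (_∈? xs) {xs = ys}

    unique-⊆-length⇒↭ : {xs ys : List A} → Unique xs → Unique ys → xs ⊆ ys → length ys ≤ length xs → xs ↭ ys
    unique-⊆-length⇒↭ {xs} {ys} u v xs⊆ys ys≤xs = unique∧set⇒↭ u v (mk⇔ xs⊆ys ys⊆xs)
      where
      ys⊆xs : ys ⊆ xs
      ys⊆xs {y} y∈ys with y ∈? xs
      ... | yes y∈xs = y∈xs
      ... | no  y∉xs = contradiction (≤-trans ys≤xs xs≤rest) (<⇒≱ rest<ys)
        where
        y≢? : Decidable (_≢ y)
        y≢? z = ¬? (z ≟ y)
        rest<ys : length (filter y≢? ys) < length ys
        rest<ys = filter-notAll y≢? ys (Any.map (λ { refl ¬¬ → ¬¬ refl }) y∈ys)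
        xs≤rest : length xs ≤ length (filter y≢? ys)
        xs≤rest = unique-⊆⇒length≤ u (Unique.filter⁺ y≢? v)
          (λ z∈xs → ∈-filter⁺ y≢? (xs⊆ys z∈xs) λ { refl → y∉xs z∈xs })

  length-filter-∁ : {P : A → Set} (P? : Decidable P) (xs : List A) →
                    length (filter P? xs) + length (filter (∁? P?) xs) ≡ length xs
  length-filter-∁ P? [] = refl
  length-filter-∁ P? (x ∷ xs) with P? x
  ... | yes _ = cong suc (length-filter-∁ P? xs)
  ... | no  _ = trans (+-suc _ _) (cong suc (length-filter-∁ P? xs))

module _ {A B : Set} where

  Unique-map⁺-local : (f : A → B) {xs : List A} → (∀ {x y} → x ∈ xs → y ∈ xs → f x ≡ f y → x ≡ y) →
                      Unique xs → Unique (map f xs)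
  Unique-map⁺-local f inj [] = []
  Unique-map⁺-local f inj (x∉xs ∷ u) =
    All.map⁺ (All.tabulate λ y∈xs fx≡fy → All.lookup x∉xs y∈xs (inj (here refl) (there y∈xs) fx≡fy))
    ∷ Unique-map⁺-local f (λ x∈ y∈ → inj (there x∈) (there y∈)) u

  length-bijection : (f : A → B) {xs : List B} {ys : List A} → Unique xs → Unique ys →
    (∀ {y y′} → y ∈ ys → y′ ∈ ys → f y ≡ f y′ → y ≡ y′) →
    (∀ {y} → y ∈ ys → f y ∈ xs) →
    (∀ {x} → x ∈ xs → ∃ λ y → y ∈ ys × f y ≡ x) →
    length xs ≡ length ys
  length-bijection f {xs} {ys} u v inj into onto =
    trans (↭-length (unique∧set⇒↭ u (Unique-map⁺-local f inj v) (mk⇔ to from))) (length-map f ys)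
    where
    to : ∀ {x} → x ∈ xs → x ∈ map f ys
    to x∈xs with y , y∈ys , refl ← onto x∈xs = ∈-map⁺ f y∈ys
    from : ∀ {x} → x ∈ map f ys → x ∈ xs
    from x∈ with y , y∈ys , refl ← ∈-map⁻ f x∈ = into y∈ys

  length-cartesianProduct : (xs : List A) (ys : List B) →
                            length (cartesianProduct xs ys) ≡ length xs * length ys
  length-cartesianProduct [] ys = refl
  length-cartesianProduct (x ∷ xs) ys =
    trans (length-++ (map (x ,_) ys)) (cong₂ _+_ (length-map (x ,_) ys) (length-cartesianProduct xs ys))

  length-concatMap : (f : A → List B) (xs : List A) → length (concatMap f xs) ≡ sum (map (length ∘ f) xs)
  length-concatMap f [] = refl
  length-concatMap f (x ∷ xs) = trans (length-++ (f x)) (cong (length (f x) +_) (length-concatMap f xs))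

  length-concatMap-const : (f : A → List B) {c : ℕ} {xs : List A} → (∀ {x} → x ∈ xs → length (f x) ≡ c) →
                           length (concatMap f xs) ≡ length xs * c
  length-concatMap-const f {xs = []} _ = refl
  length-concatMap-const f {xs = x ∷ xs} len =
    trans (length-++ (f x)) (cong₂ _+_ (len (here refl)) (length-concatMap-const f (len ∘ there)))

  Unique-concatMap⁺ : (f : A → List B) {xs : List A} → Unique xs → (∀ {x} → x ∈ xs → Unique (f x)) →
    (∀ {x x′ z} → x ∈ xs → x′ ∈ xs → z ∈ f x → z ∈ f x′ → x ≡ x′) → Unique (concatMap f xs)
  Unique-concatMap⁺ f [] _ _ = []
  Unique-concatMap⁺ f {x ∷ xs} (x∉xs ∷ u) uf disjoint =
    Unique.++⁺ (uf (here refl)) (Unique-concatMap⁺ f u (uf ∘ there) (λ p q → disjoint (there p) (there q)))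
      λ (z∈fx , z∈rest) →
        let x′ , x′∈xs , z∈fx′ = find (∈-concatMap⁻ f {xs = xs} z∈rest)
        in All.lookup x∉xs x′∈xs (disjoint (here refl) (there x′∈xs) z∈fx z∈fx′)

module _ {A : Set} where

  Unique-resp-↭ : {xs ys : List A} → xs ↭ ys → Unique xs → Unique ys
  Unique-resp-↭ = PermutationSetoid.Unique-resp-↭ (setoid A) ∘ ↭⇒↭ₛ

  Unique-++⁻ˡ : (xs : List A) {ys : List A} → Unique (xs ++ ys) → Unique xs
  Unique-++⁻ˡ []       _          = []
  Unique-++⁻ˡ (x ∷ xs) (x∉xs ∷ u) = All.++⁻ˡ xs x∉xs ∷ Unique-++⁻ˡ xs u

  ++-∷-trichotomy : (xs : List A) (y : A) (ys xs′ : List A) (y′ : A) (ys′ : List A) →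
    xs ++ y ∷ ys ≡ xs′ ++ y′ ∷ ys′ →
    (xs ≡ xs′ × y ≡ y′ × ys ≡ ys′) ⊎
    (∃ λ zs → xs′ ≡ xs ++ y ∷ zs × ys ≡ zs ++ y′ ∷ ys′) ⊎
    (∃ λ zs → xs ≡ xs′ ++ y′ ∷ zs × ys′ ≡ zs ++ y ∷ ys)
  ++-∷-trichotomy []       y ys []         y′ ys′ refl = inj₁ (refl , refl , refl)
  ++-∷-trichotomy []       y ys (x′ ∷ xs′) y′ ys′ refl = inj₂ (inj₁ (xs′ , refl , refl))
  ++-∷-trichotomy (x ∷ xs) y ys []         y′ ys′ refl = inj₂ (inj₂ (xs , refl , refl))
  ++-∷-trichotomy (x ∷ xs) y ys (x′ ∷ xs′) y′ ys′ eq
    with refl , eq′ ← ∷-injective eq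
    with ++-∷-trichotomy xs y ys xs′ y′ ys′ eq′
  ... | inj₁ (refl , refl , refl)      = inj₁ (refl , refl , refl)
  ... | inj₂ (inj₁ (zs , refl , refl)) = inj₂ (inj₁ (zs , refl , refl))
  ... | inj₂ (inj₂ (zs , refl , refl)) = inj₂ (inj₂ (zs , refl , refl))

  ++-∷-injective : {y : A} (xs ys xs′ ys′ : List A) → y ∉ xs → y ∉ xs′ →
                   xs ++ y ∷ ys ≡ xs′ ++ y ∷ ys′ → xs ≡ xs′ × ys ≡ ys′
  ++-∷-injective xs ys xs′ ys′ y∉xs y∉xs′ eq with ++-∷-trichotomy xs _ ys xs′ _ ys′ eq
  ... | inj₁ (refl , _ , refl)     = refl , refl
  ... | inj₂ (inj₁ (_ , refl , _)) = contradiction (∈-insert xs) y∉xs′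
  ... | inj₂ (inj₂ (_ , refl , _)) = contradiction (∈-insert xs′) y∉xs

  ++-cancelˡ-↭ : (xs : List A) {ys zs : List A} → xs ++ ys ↭ xs ++ zs → ys ↭ zs
  ++-cancelˡ-↭ []       p = p
  ++-cancelˡ-↭ (x ∷ xs) p = ++-cancelˡ-↭ xs (drop-∷ p)

  applyUpTo-+ : (f : ℕ → A) (k n : ℕ) → applyUpTo f (k + n) ≡ applyUpTo f k ++ applyUpTo (f ∘ (k +_)) n
  applyUpTo-+ f zero    n = refl
  applyUpTo-+ f (suc k) n = cong (f 0 ∷_) (applyUpTo-+ (f ∘ suc) k n)

-- Permutations of 1, …, n as lists

oneTo : ℕ → List ℕ
oneTo = applyUpTo suc

Unique-oneTo : ∀ n → Unique (oneTo n)
Unique-oneTo n = Unique.applyUpTo⁺₁ suc n λ i<j _ → <⇒≢ (s≤s i<j)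

∈-oneTo⁺ : ∀ {v n} → 1 ≤ v → v ≤ n → v ∈ oneTo n
∈-oneTo⁺ {suc v} _ v<n = ∈-applyUpTo⁺ suc v<n

∈-oneTo⁻ : ∀ {v n} → v ∈ oneTo n → 1 ≤ v × v ≤ n
∈-oneTo⁻ v∈ with i , i<n , refl ← ∈-applyUpTo⁻ suc v∈ = s≤s z≤n , i<n

length-↭-oneTo : ∀ {n σ} → σ ↭ oneTo n → length σ ≡ n
length-↭-oneTo {n} p = trans (↭-length p) (length-applyUpTo suc n)

suc-∉-oneTo : ∀ {n σ} → σ ↭ oneTo n → suc n ∉ σ
suc-∉-oneTo p sn∈σ = <-irrefl refl (proj₂ (∈-oneTo⁻ (∈-resp-↭ p sn∈σ)))

oneTo-+ : ∀ k l → oneTo (k + suc l) ≡ oneTo k ++ suc k ∷ map (suc k +_) (oneTo l)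
oneTo-+ k l = begin
  oneTo (k + suc l)                            ≡⟨ applyUpTo-+ suc k (suc l) ⟩
  oneTo k ++ suc (k + 0) ∷ above               ≡⟨ cong (λ t → oneTo k ++ suc t ∷ above) (+-identityʳ k) ⟩
  oneTo k ++ suc k ∷ above                     ≡⟨ cong (λ t → oneTo k ++ suc k ∷ t) (map-applyUpTo suc (suc k +_) l) ⟨
  oneTo k ++ suc k ∷ map (suc k +_) (oneTo l)  ∎
  where
  open ≡-Reasoning
  above : List ℕ
  above = applyUpTo (λ i → suc k + suc i) l

insertions : ∀ {A : Set} → A → List A → List (List A)
insertions x []       = [ [ x ] ]
insertions x (y ∷ ys) = (x ∷ y ∷ ys) ∷ map (y ∷_) (insertions x ys)

module _ {A : Set} {x : A} where

  length-insertions : (ys : List A) → length (insertions x ys) ≡ suc (length ys)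
  length-insertions []       = refl
  length-insertions (y ∷ ys) = cong suc (trans (length-map (y ∷_) (insertions x ys)) (length-insertions ys))

  ∈-insertions⁺ : (as bs : List A) → as ++ x ∷ bs ∈ insertions x (as ++ bs)
  ∈-insertions⁺ []       []       = here refl
  ∈-insertions⁺ []       (b ∷ bs) = here refl
  ∈-insertions⁺ (a ∷ as) bs       = there (∈-map⁺ (a ∷_) (∈-insertions⁺ as bs))

  ∈-insertions⁻ : ∀ {zs} (ys : List A) → zs ∈ insertions x ys → ∃₂ λ as bs → ys ≡ as ++ bs × zs ≡ as ++ x ∷ bs
  ∈-insertions⁻ []       (here refl) = [] , [] , refl , refl
  ∈-insertions⁻ (y ∷ ys) (here refl) = [] , y ∷ ys , refl , refl
  ∈-insertions⁻ (y ∷ ys) (there zs∈)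
    with _ , zs′∈ , refl ← ∈-map⁻ (y ∷_) zs∈
    with as , bs , refl , refl ← ∈-insertions⁻ ys zs′∈ = y ∷ as , bs , refl , refl

  Unique-insertions : ∀ {ys : List A} → x ∉ ys → Unique (insertions x ys)
  Unique-insertions {[]}     _    = [] ∷ []
  Unique-insertions {y ∷ ys} x∉ys =
    All.map⁺ (All.tabulate λ _ eq → x∉ys (here (∷-injectiveˡ eq)))
    ∷ Unique.map⁺ ∷-injectiveʳ (Unique-insertions (x∉ys ∘ there))

perms : ℕ → List (List ℕ)
perms zero    = [ [] ]
perms (suc n) = concatMap (insertions (suc n)) (perms n)

perms-sound : ∀ n {σ} → σ ∈ perms n → σ ↭ oneTo n
perms-sound zero    (here refl) = ↭-refl
perms-sound (suc n) σ∈
  with τ , τ∈ , σ∈ins ← find (∈-concatMap⁻ (insertions (suc n)) {xs = perms n} σ∈)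
  with as , bs , refl , refl ← ∈-insertions⁻ τ σ∈ins = begin
    as ++ suc n ∷ bs  ↭⟨ shift (suc n) as bs ⟩
    suc n ∷ as ++ bs  ↭⟨ prep (suc n) (perms-sound n τ∈) ⟩
    suc n ∷ oneTo n   ↭⟨ ∷↭∷ʳ (suc n) (oneTo n) ⟩
    oneTo n ∷ʳ suc n  ≡⟨ applyUpTo-∷ʳ suc n ⟩
    oneTo (suc n)     ∎
  where open PermutationReasoning

perms-complete : ∀ n {σ} → σ ↭ oneTo n → σ ∈ perms n
perms-complete zero    p rewrite ↭-empty-inv p = here refl
perms-complete (suc n) {σ} p
  with as , bs , refl ← ∈-∃++ (∈-resp-↭ (↭-sym p) (∈-oneTo⁺ {suc n} (s≤s z≤n) ≤-refl)) =
  ∈-concatMap⁺ (insertions (suc n)) (Any.map (λ { refl → ∈-insertions⁺ as bs }) (perms-complete n rest))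
  where
  rest : as ++ bs ↭ oneTo n
  rest = ↭-trans (drop-mid as (oneTo n) (subst (as ++ [ suc n ] ++ bs ↭_) (sym (applyUpTo-∷ʳ suc n)) p))
                 (↭-reflexive (++-identityʳ (oneTo n)))

Unique-perms : ∀ n → Unique (perms n)
Unique-perms zero    = [] ∷ []
Unique-perms (suc n) = Unique-concatMap⁺ (insertions (suc n)) (Unique-perms n)
  (λ τ∈ → Unique-insertions (suc-∉-oneTo (perms-sound n τ∈))) disjoint
  where
  disjoint : ∀ {τ τ′ σ} → τ ∈ perms n → τ′ ∈ perms n →
             σ ∈ insertions (suc n) τ → σ ∈ insertions (suc n) τ′ → τ ≡ τ′
  disjoint {τ} {τ′} τ∈ τ′∈ σ∈ σ∈′
    with as , bs , refl , refl ← ∈-insertions⁻ τ σ∈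
    with as′ , bs′ , refl , eq ← ∈-insertions⁻ τ′ σ∈′
    with refl , refl ← ++-∷-injective as bs as′ bs′
           (suc-∉-oneTo (perms-sound n τ∈) ∘ ∈-++⁺ˡ) (suc-∉-oneTo (perms-sound n τ′∈) ∘ ∈-++⁺ˡ) eq = refl

length-perms : ∀ n → length (perms n) ≡ n !
length-perms zero    = refl
length-perms (suc n) = begin
  length (concatMap (insertions (suc n)) (perms n)) ≡⟨ length-concatMap-const (insertions (suc n)) insertions-length ⟩
  length (perms n) * suc n                          ≡⟨ cong (_* suc n) (length-perms n) ⟩
  n ! * suc n                                       ≡⟨ *-comm (n !) (suc n) ⟩
  suc n !                                           ∎
  where
  open ≡-Reasoning
  insertions-length : ∀ {τ} → τ ∈ perms n → length (insertions (suc n) τ) ≡ suc n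
  insertions-length {τ} τ∈ = trans (length-insertions τ) (cong suc (length-↭-oneTo (perms-sound n τ∈)))

module _ {A : Set} {n : ℕ} where

  All-toList⁺ : {P : A → Set} {v : Vec A n} → (∀ i → P (lookup v i)) → All P (toList v)
  All-toList⁺ = VAll.toList⁺ ∘ VAll.lookup⁻

  All-toList⁻ : {P : A → Set} {v : Vec A n} → All P (toList v) → ∀ i → P (lookup v i)
  All-toList⁻ = VAll.lookup⁺ ∘ VAll.toList⁻

  ∈-toList⇒lookup : ∀ {z} (v : Vec A n) → z ∈ toList v → ∃ λ i → lookup v i ≡ z
  ∈-toList⇒lookup v z∈ = let p = Vec∈.∈-toList⁻ z∈ in VAny.index p , sym (VAnyProperties.lookup-index p)

Unique-toList⁺ : ∀ {A : Set} {n} (v : Vec A n) → (∀ i j → lookup v i ≡ lookup v j → i ≡ j) → Unique (toList v)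
Unique-toList⁺ Vec.[]  _   = []
Unique-toList⁺ (x ∷ w) inj =
  All-toList⁺ (λ j eq → case inj zero (suc j) eq of λ ()) ∷
  Unique-toList⁺ w (λ i j eq → Fin.suc-injective (inj (suc i) (suc j) eq))

Unique-toList⁻ : ∀ {A : Set} {n} (v : Vec A n) → Unique (toList v) → ∀ i j → lookup v i ≡ lookup v j → i ≡ j
Unique-toList⁻ (x ∷ w) _         zero    zero    _  = refl
Unique-toList⁻ (x ∷ w) (x∉w ∷ _) zero    (suc j) eq = contradiction eq (All-toList⁻ x∉w j)
Unique-toList⁻ (x ∷ w) (x∉w ∷ _) (suc i) zero    eq = contradiction (sym eq) (All-toList⁻ x∉w i)
Unique-toList⁻ (x ∷ w) (_ ∷ u)   (suc i) (suc j) eq = cong suc (Unique-toList⁻ w u i j eq)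

IsPerm⇔↭ : ∀ {n} (v : Vec ℕ n) → IsPerm v ⇔ (toList v ↭ oneTo n)
IsPerm⇔↭ {n} v = mk⇔ to from
  where
  to : IsPerm v → toList v ↭ oneTo n
  to (range , inj) = unique-⊆-length⇒↭ ℕ._≟_ (Unique-toList⁺ v inj) (Unique-oneTo n) entries
    (≤-reflexive (trans (length-applyUpTo suc n) (sym (length-toList v))))
    where
    entries : toList v ⊆ oneTo n
    entries z∈ with i , refl ← ∈-toList⇒lookup v z∈ = uncurry ∈-oneTo⁺ (range i)
  from : toList v ↭ oneTo n → IsPerm v
  from p = (λ i → ∈-oneTo⁻ (∈-resp-↭ p (Vec∈.∈-toList⁺ (Vec∈.∈-lookup i v)))) ,
           Unique-toList⁻ v (Unique-resp-↭ (↭-sym p) (Unique-oneTo n))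

IsPerm-surjective : ∀ {n z} (v : Vec ℕ n) → IsPerm v → 1 ≤ z → z ≤ n → ∃ λ i → lookup v i ≡ z
IsPerm-surjective v perm 1≤z z≤size =
  ∈-toList⇒lookup v (∈-resp-↭ (↭-sym (Equivalence.to (IsPerm⇔↭ v) perm)) (∈-oneTo⁺ 1≤z z≤size))

toVec : (n : ℕ) → List ℕ → Vec ℕ n
toVec zero    _        = Vec.[]
toVec (suc n) []       = 0 ∷ toVec n []
toVec (suc n) (x ∷ xs) = x ∷ toVec n xs

toList-toVec : ∀ {n} (xs : List ℕ) → length xs ≡ n → toList (toVec n xs) ≡ xs
toList-toVec {zero}  []       _  = refl
toList-toVec {suc n} (x ∷ xs) eq = cong (x ∷_) (toList-toVec xs (suc-injective eq))

toVec-toList : ∀ {n} (v : Vec ℕ n) → toVec n (toList v) ≡ v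
toVec-toList Vec.[]  = refl
toVec-toList (x ∷ v) = cong (x ∷_) (toVec-toList v)

-- Strong fixed points

StrongFixedPoint : List ℕ → ℕ → List ℕ → Set
StrongFixedPoint xs y ys = All (_< y) xs × All (y <_) ys

HasStrongFixedPointₗ : List ℕ → Set
HasStrongFixedPointₗ σ = ∃[ xs ] ∃[ y ] ∃[ ys ] σ ≡ xs ++ y ∷ ys × StrongFixedPoint xs y ys

StrongFixedPointAt : ∀ {n} → Vec ℕ n → Fin n → Set
StrongFixedPointAt {n} v k =
  (∀ (j : Fin n) → toℕ j < toℕ k → lookup v j < lookup v k) ×
  (∀ (j : Fin n) → toℕ k < toℕ j → lookup v k < lookup v j)

StrongFixedPointAt⇒ₗ : ∀ {n} (v : Vec ℕ n) k → StrongFixedPointAt v k →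
  ∃₂ λ xs ys → toList v ≡ xs ++ lookup v k ∷ ys × StrongFixedPoint xs (lookup v k) ys
StrongFixedPointAt⇒ₗ (x ∷ w) zero (_ , above) =
  [] , toList w , refl , [] , All-toList⁺ (λ j → above (suc j) (s≤s z≤n))
StrongFixedPointAt⇒ₗ (x ∷ w) (suc k) (below , above)
  with xs , ys , eq , below′ , above′ ←
         StrongFixedPointAt⇒ₗ w k ((λ j j<k → below (suc j) (s≤s j<k)) , (λ j k<j → above (suc j) (s≤s k<j))) =
  x ∷ xs , ys , cong (x ∷_) eq , below zero (s≤s z≤n) ∷ below′ , above′

StrongFixedPointAt⇐ₗ : ∀ {n} (v : Vec ℕ n) xs y ys → toList v ≡ xs ++ y ∷ ys → StrongFixedPoint xs y ys →
  ∃ λ k → lookup v k ≡ y × StrongFixedPointAt v k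
StrongFixedPointAt⇐ₗ (x ∷ w) [] y ys eq ([] , above) with refl , refl ← ∷-injective eq =
  zero , refl , (λ _ ()) , λ { (suc j) _ → All-toList⁻ above j }
StrongFixedPointAt⇐ₗ (x ∷ w) (x′ ∷ xs) y ys eq (x<y ∷ below , above)
  with refl , eq′ ← ∷-injective eq
  with k , refl , below′ , above′ ← StrongFixedPointAt⇐ₗ w xs y ys eq′ (below , above) =
  suc k , refl , (λ { zero _ → x<y ; (suc j) (s≤s j<k) → below′ j j<k }) , λ { (suc j) (s≤s k<j) → above′ j k<j }

HasStrongFixedPoint⇔ₗ : ∀ {n} (v : Vec ℕ n) → HasStrongFixedPoint v ⇔ HasStrongFixedPointₗ (toList v)
HasStrongFixedPoint⇔ₗ v = mk⇔ to from
  where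
  to : HasStrongFixedPoint v → HasStrongFixedPointₗ (toList v)
  to (k , p) = let xs , ys , eq , q = StrongFixedPointAt⇒ₗ v k p in xs , lookup v k , ys , eq , q
  from : HasStrongFixedPointₗ (toList v) → HasStrongFixedPoint v
  from (xs , y , ys , eq , q) = let k , _ , p = StrongFixedPointAt⇐ₗ v xs y ys eq q in k , p

hasStrongFixedPoint? : ∀ {n} (v : Vec ℕ n) → Dec (HasStrongFixedPoint v)
hasStrongFixedPoint? v = any? λ k →
  all? (λ j → toℕ j <? toℕ k →-dec lookup v j <? lookup v k) ×-dec
  all? (λ j → toℕ k <? toℕ j →-dec lookup v k <? lookup v j)

hasStrongFixedPointₗ? : Decidable HasStrongFixedPointₗ
hasStrongFixedPointₗ? σ = Dec.map′
  (subst HasStrongFixedPointₗ (toList∘fromList σ) ∘ to)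
  (from ∘ subst HasStrongFixedPointₗ (sym (toList∘fromList σ)))
  (hasStrongFixedPoint? (fromList σ))
  where open Equivalence (HasStrongFixedPoint⇔ₗ (fromList σ))

StrongFixedPoint-prefix : ∀ {xs y ys z zs} → StrongFixedPoint xs y ys → StrongFixedPoint (xs ++ y ∷ ys) z zs →
                          StrongFixedPoint xs y (ys ++ z ∷ zs)
StrongFixedPoint-prefix {xs} {y} {z = z} (below , above) (below′ , above′) =
  below , All.++⁺ above (y<z ∷ All.map (<-trans y<z) above′)
  where
  y<z : y < z
  y<z = All.lookup below′ (∈-insert xs)

FirstStrongFixedPoint : List ℕ → ℕ → List ℕ → Set
FirstStrongFixedPoint xs y ys = StrongFixedPoint xs y ys × ¬ HasStrongFixedPointₗ xs

HasFirstStrongFixedPoint : List ℕ → Set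
HasFirstStrongFixedPoint σ = ∃[ xs ] ∃[ y ] ∃[ ys ] σ ≡ xs ++ y ∷ ys × FirstStrongFixedPoint xs y ys

firstStrongFixedPoint : ∀ {σ} → HasStrongFixedPointₗ σ → HasFirstStrongFixedPoint σ
firstStrongFixedPoint (xs , y , ys , refl , p) = go xs (<-wellFounded (length xs)) p
  where
  shorter : ∀ (xs₁ : List ℕ) {y₁} ys₁ → length xs₁ < length (xs₁ ++ y₁ ∷ ys₁)
  shorter xs₁ ys₁ = subst (length xs₁ <_) (sym (length-++ xs₁)) (m<m+n (length xs₁) (s≤s z≤n))
  go : ∀ xs {y ys} → Acc _<_ (length xs) → StrongFixedPoint xs y ys → HasFirstStrongFixedPoint (xs ++ y ∷ ys)
  go xs {y} {ys} (acc rs) p with hasStrongFixedPointₗ? xs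
  ... | no ¬q = xs , _ , _ , refl , p , ¬q
  ... | yes (xs₁ , y₁ , ys₁ , refl , q)
    with xs′ , y′ , ys′ , eq , r ← go xs₁ (rs (shorter xs₁ ys₁)) (StrongFixedPoint-prefix q p) =
    xs′ , y′ , ys′ , trans (++-assoc xs₁ (y₁ ∷ ys₁) (y ∷ ys)) eq , r

FirstStrongFixedPoint-unique : ∀ {xs y ys xs′ y′ ys′} → xs ++ y ∷ ys ≡ xs′ ++ y′ ∷ ys′ →
  FirstStrongFixedPoint xs y ys → FirstStrongFixedPoint xs′ y′ ys′ → xs ≡ xs′ × y ≡ y′ × ys ≡ ys′
FirstStrongFixedPoint-unique {xs} {y} {ys} {xs′} {y′} {ys′} eq ((below , above) , ¬q) ((below′ , above′) , ¬q′)
  with ++-∷-trichotomy xs y ys xs′ y′ ys′ eq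
... | inj₁ same = same
... | inj₂ (inj₁ (zs , refl , refl)) = contradiction (xs , y , zs , refl , below , All.++⁻ˡ zs above) ¬q′
... | inj₂ (inj₂ (zs , refl , refl)) = contradiction (xs′ , y′ , zs , refl , below′ , All.++⁻ˡ zs above′) ¬q

-- Cutting a permutation at a strong fixed point

glue : List ℕ × List ℕ → List ℕ
glue (α , β) = α ++ suc (length α) ∷ map (suc (length α) +_) β

glue-↭ : ∀ {k l α β} → α ↭ oneTo k → β ↭ oneTo l → glue (α , β) ↭ oneTo (k + suc l)
glue-↭ {k} {l} {α} {β} p q rewrite length-↭-oneTo p = begin
  α ++ suc k ∷ map (suc k +_) β               ↭⟨ ++⁺ p (prep (suc k) (map⁺ (suc k +_) q)) ⟩
  oneTo k ++ suc k ∷ map (suc k +_) (oneTo l) ≡⟨ oneTo-+ k l ⟨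
  oneTo (k + suc l)                           ∎
  where open PermutationReasoning

glue-StrongFixedPoint : ∀ {k l α β} → α ↭ oneTo k → β ↭ oneTo l →
                        StrongFixedPoint α (suc (length α)) (map (suc (length α) +_) β)
glue-StrongFixedPoint {k} p q rewrite length-↭-oneTo p =
  All.tabulate (λ v∈α → s≤s (proj₂ (∈-oneTo⁻ (∈-resp-↭ p v∈α)))) ,
  All.map⁺ (All.tabulate λ v∈β → m<m+n (suc k) (proj₁ (∈-oneTo⁻ (∈-resp-↭ q v∈β))))

glue-injective : ∀ {α β α′ β′} →
  FirstStrongFixedPoint α (suc (length α)) (map (suc (length α) +_) β) →
  FirstStrongFixedPoint α′ (suc (length α′)) (map (suc (length α′) +_) β′) →
  glue (α , β) ≡ glue (α′ , β′) → (α , β) ≡ (α′ , β′)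
glue-injective {α} first first′ eq with refl , _ , eq′ ← FirstStrongFixedPoint-unique eq first first′ =
  cong (α ,_) (map-injective (+-cancelˡ-≡ (suc (length α)) _ _) eq′)

StrongFixedPoint-decomposition : ∀ {m xs y ys} → xs ++ y ∷ ys ↭ oneTo m → StrongFixedPoint xs y ys →
  y ≡ suc (length xs) × length xs < m × xs ↭ oneTo (length xs) ×
  ∃ λ β → ys ≡ map (y +_) β × β ↭ oneTo (m ∸ y)
StrongFixedPoint-decomposition {m} {xs} {y} {ys} p (below , above)
  with y₀ , y₀<m , refl ← ∈-applyUpTo⁻ suc (∈-resp-↭ p (∈-insert xs)) =
  let β , ys≡ , oneTo↭β = ↭-map-inv (suc y₀ +_) (↭-sym ys↭)
  in cong suc (sym k≡y₀) , subst (_< m) (sym k≡y₀) y₀<m , subst (λ t → xs ↭ oneTo t) (sym k≡y₀) xs↭ ,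
     β , ys≡ , ↭-sym oneTo↭β
  where
  l : ℕ
  l = m ∸ suc y₀
  xs↭ : xs ↭ oneTo y₀
  xs↭ = unique∧set⇒↭ (Unique-++⁻ˡ xs (Unique-resp-↭ (↭-sym p) (Unique-oneTo m))) (Unique-oneTo y₀) (mk⇔ to from)
    where
    to : ∀ {v} → v ∈ xs → v ∈ oneTo y₀
    to v∈xs = ∈-oneTo⁺ (proj₁ (∈-oneTo⁻ (∈-resp-↭ p (∈-++⁺ˡ v∈xs)))) (≤-pred (All.lookup below v∈xs))
    from : ∀ {v} → v ∈ oneTo y₀ → v ∈ xs
    from v∈ with 1≤v , v≤y₀ ← ∈-oneTo⁻ v∈
      with ∈-++⁻ xs (∈-resp-↭ (↭-sym p) (∈-oneTo⁺ 1≤v (≤-trans v≤y₀ (<⇒≤ y₀<m))))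
    ... | inj₁ v∈xs          = v∈xs
    ... | inj₂ (here refl)   = contradiction v≤y₀ (<-irrefl refl ∘ s≤s)
    ... | inj₂ (there v∈ys)  = contradiction (All.lookup above v∈ys) (<-asym (s≤s v≤y₀))
  k≡y₀ : length xs ≡ y₀
  k≡y₀ = length-↭-oneTo xs↭
  ys↭ : ys ↭ map (suc y₀ +_) (oneTo l)
  ys↭ = drop-∷ (++-cancelˡ-↭ xs (begin
    xs ++ suc y₀ ∷ ys                                ↭⟨ p ⟩
    oneTo m                                          ≡⟨ cong oneTo (trans (+-suc y₀ l) (m+[n∸m]≡n y₀<m)) ⟨
    oneTo (y₀ + suc l)                               ≡⟨ oneTo-+ y₀ l ⟩
    oneTo y₀ ++ suc y₀ ∷ map (suc y₀ +_) (oneTo l)   ↭⟨ ++⁺ʳ _ (↭-sym xs↭) ⟩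
    xs ++ suc y₀ ∷ map (suc y₀ +_) (oneTo l)         ∎))
    where open PermutationReasoning

-- Counting permutations by their first strong fixed point

withStrongFixedPoint : ℕ → List (List ℕ)
withStrongFixedPoint m = filter hasStrongFixedPointₗ? (perms m)

withoutStrongFixedPoint : ℕ → List (List ℕ)
withoutStrongFixedPoint k = filter (∁? hasStrongFixedPointₗ?) (perms k)

#withoutStrongFixedPoint : ℕ → ℕ
#withoutStrongFixedPoint k = length (withoutStrongFixedPoint k)

piecesAt : ℕ → ℕ → List (List ℕ × List ℕ)
piecesAt m k = cartesianProduct (withoutStrongFixedPoint k) (perms (m ∸ suc k))

pieces : ℕ → List (List ℕ × List ℕ)
pieces m = concatMap (piecesAt m) (upTo m)

#pieces : ℕ → ℕ
#pieces m = sum (map (λ k → #withoutStrongFixedPoint k * (m ∸ suc k) !) (upTo m))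

length-pieces : ∀ m → length (pieces m) ≡ #pieces m
length-pieces m = trans (length-concatMap (piecesAt m) (upTo m)) (cong sum (map-cong count (upTo m)))
  where
  count : ∀ k → length (piecesAt m k) ≡ #withoutStrongFixedPoint k * (m ∸ suc k) !
  count k = trans (length-cartesianProduct (withoutStrongFixedPoint k) (perms (m ∸ suc k)))
                  (cong (#withoutStrongFixedPoint k *_) (length-perms (m ∸ suc k)))

∈-pieces⁺ : ∀ {m k α β} → k < m → α ↭ oneTo k → ¬ HasStrongFixedPointₗ α → β ↭ oneTo (m ∸ suc k) →
            (α , β) ∈ pieces m
∈-pieces⁺ {m} {k} {α} {β} k<m α↭ ¬α β↭ =
  ∈-concatMap⁺ (piecesAt m) (Any.map (λ { refl → p∈ }) (∈-upTo⁺ k<m))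
  where
  p∈ : (α , β) ∈ piecesAt m k
  p∈ = ∈-cartesianProduct⁺ (∈-filter⁺ (∁? hasStrongFixedPointₗ?) (perms-complete k α↭) ¬α) (perms-complete (m ∸ suc k) β↭)

∈-piecesAt⁻ : ∀ {m k α β} → (α , β) ∈ piecesAt m k →
  α ↭ oneTo k × ¬ HasStrongFixedPointₗ α × β ↭ oneTo (m ∸ suc k)
∈-piecesAt⁻ {m} {k} p∈
  with α∈ , β∈ ← ∈-cartesianProduct⁻ (withoutStrongFixedPoint k) (perms (m ∸ suc k)) p∈
  with α∈perms , ¬α ← ∈-filter⁻ (∁? hasStrongFixedPointₗ?) α∈ =
  perms-sound k α∈perms , ¬α , perms-sound (m ∸ suc k) β∈

∈-pieces⁻ : ∀ {m α β} → (α , β) ∈ pieces m →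
  ∃ λ k → k < m × α ↭ oneTo k × ¬ HasStrongFixedPointₗ α × β ↭ oneTo (m ∸ suc k)
∈-pieces⁻ {m} p∈ with k , k∈ , p∈k ← find (∈-concatMap⁻ (piecesAt m) {xs = upTo m} p∈) =
  k , ∈-upTo⁻ k∈ , ∈-piecesAt⁻ {m} p∈k

Unique-pieces : ∀ m → Unique (pieces m)
Unique-pieces m = Unique-concatMap⁺ (piecesAt m) (Unique.upTo⁺ m)
  (λ {k} _ → Unique.cartesianProduct⁺ (Unique.filter⁺ (∁? hasStrongFixedPointₗ?) (Unique-perms k))
                                       (Unique-perms (m ∸ suc k)))
  λ {k} {k′} _ _ p∈k p∈k′ → trans (sym (length-of p∈k)) (length-of p∈k′)
  where
  length-of : ∀ {k α β} → (α , β) ∈ piecesAt m k → length α ≡ k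
  length-of {k} p∈k = length-↭-oneTo (proj₁ (∈-piecesAt⁻ {m} {k} p∈k))

pieces-glue : ∀ {m α β} → (α , β) ∈ pieces m →
  glue (α , β) ↭ oneTo m × FirstStrongFixedPoint α (suc (length α)) (map (suc (length α) +_) β)
pieces-glue {m} p∈ with k , k<m , α↭ , ¬α , β↭ ← ∈-pieces⁻ {m} p∈ =
  subst (λ t → glue _ ↭ oneTo t) (trans (+-suc k (m ∸ suc k)) (m+[n∸m]≡n k<m)) (glue-↭ α↭ β↭) ,
  glue-StrongFixedPoint α↭ β↭ , ¬α

length-withStrongFixedPoint : ∀ m → length (withStrongFixedPoint m) ≡ length (pieces m)
length-withStrongFixedPoint m =
  length-bijection glue (Unique.filter⁺ hasStrongFixedPointₗ? (Unique-perms m)) (Unique-pieces m) injective into onto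
  where
  injective : ∀ {p p′} → p ∈ pieces m → p′ ∈ pieces m → glue p ≡ glue p′ → p ≡ p′
  injective p∈ p′∈ =
    glue-injective (proj₂ (pieces-glue {m} p∈)) (proj₂ (pieces-glue {m} p′∈))
  into : ∀ {p} → p ∈ pieces m → glue p ∈ withStrongFixedPoint m
  into {α , β} p∈ = let glue↭ , fixedPoint , _ = pieces-glue {m} p∈ in
    ∈-filter⁺ hasStrongFixedPointₗ? (perms-complete m glue↭) (α , _ , _ , refl , fixedPoint)
  onto : ∀ {σ} → σ ∈ withStrongFixedPoint m → ∃ λ p → p ∈ pieces m × glue p ≡ σ
  onto σ∈
    with σ∈perms , q ← ∈-filter⁻ hasStrongFixedPointₗ? {xs = perms m} σ∈
    with xs , y , ys , refl , first , ¬xs ← firstStrongFixedPoint q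
    with refl , k<m , xs↭ , β , refl , β↭ ← StrongFixedPoint-decomposition (perms-sound m σ∈perms) first =
    (xs , β) , ∈-pieces⁺ k<m xs↭ ¬xs β↭ , refl

factorial-recurrence : ∀ m → m ! ≡ #withoutStrongFixedPoint m + #pieces m
factorial-recurrence m = begin
  m !                                                          ≡⟨ length-perms m ⟨
  length (perms m)                                             ≡⟨ length-filter-∁ hasStrongFixedPointₗ? (perms m) ⟨
  length (withStrongFixedPoint m) + #withoutStrongFixedPoint m ≡⟨ +-comm _ (#withoutStrongFixedPoint m) ⟩
  #withoutStrongFixedPoint m + length (withStrongFixedPoint m) ≡⟨ cong (#withoutStrongFixedPoint m +_) counted ⟩
  #withoutStrongFixedPoint m + #pieces m                       ∎
  where
  open ≡-Reasoning
  counted : length (withStrongFixedPoint m) ≡ #pieces m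
  counted = trans (length-withStrongFixedPoint m) (length-pieces m)

-- The coefficients of F(x) / (1 + x F(x))

zip-map : ∀ {A B : Set} (g : A → B) (xs : List A) → zip xs (map g xs) ≡ map (λ x → x , g x) xs
zip-map g []       = refl
zip-map g (x ∷ xs) = cong ((x , g x) ∷_) (zip-map g xs)

-- The coefficient list and the summand inside divPS are private to Defs: they enter as the
-- arguments c and φ of unfolded, which unification solves.
divPS-recurrence : ∀ f h m → divPS f h m ≡ f m ℤ.- sumℤ (map (λ k → divPS f h k ℤ.* h (m ∸ k)) (upTo m))
divPS-recurrence f h = unfolded _ _ (λ _ → refl) (λ _ _ _ → refl) refl (λ _ → refl)
  where
  unfolded : (c : ℕ → List ℤ) (φ : ℕ → ℕ × ℤ → ℤ) →
    (∀ m → divPS f h m ≡ f m ℤ.- sumℤ (map (φ m) (zip (upTo m) (c m)))) →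
    (∀ m k q → φ m (k , q) ≡ q ℤ.* h (m ∸ k)) →
    c zero ≡ [] → (∀ m → c (suc m) ≡ c m ++ [ divPS f h m ]) →
    ∀ m → divPS f h m ≡ f m ℤ.- sumℤ (map (λ k → divPS f h k ℤ.* h (m ∸ k)) (upTo m))
  unfolded c φ c-def φ-def c₀ c-suc m = begin
    divPS f h m                                          ≡⟨ c-def m ⟩
    f-minus-sum (map (φ m) (zip (upTo m) (c m)))         ≡⟨ cong (f-minus-sum ∘ map (φ m)) zipped ⟩
    f-minus-sum (map (φ m) (map (λ k → k , q k) (upTo m))) ≡⟨ cong f-minus-sum (map-∘ (upTo m)) ⟨
    f-minus-sum (map (λ k → φ m (k , q k)) (upTo m))     ≡⟨ cong f-minus-sum (map-cong φ-def′ (upTo m)) ⟩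
    f-minus-sum (map (λ k → q k ℤ.* h (m ∸ k)) (upTo m)) ∎
    where
    open ≡-Reasoning
    q : ℕ → ℤ
    q = divPS f h
    f-minus-sum : List ℤ → ℤ
    f-minus-sum t = f m ℤ.- sumℤ t
    c≡ : ∀ m → c m ≡ map q (upTo m)
    c≡ zero    = c₀
    c≡ (suc m) = begin
      c (suc m)                   ≡⟨ c-suc m ⟩
      c m ++ [ q m ]              ≡⟨ cong (_++ [ q m ]) (c≡ m) ⟩
      map q (upTo m) ++ [ q m ]   ≡⟨ map-++ q (upTo m) [ m ] ⟨
      map q (upTo m ∷ʳ m)         ≡⟨ cong (map q) (upTo-∷ʳ m) ⟩
      map q (upTo (suc m))        ∎
    zipped : zip (upTo m) (c m) ≡ map (λ k → k , q k) (upTo m)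
    zipped = trans (cong (zip (upTo m)) (c≡ m)) (zip-map q (upTo m))
    φ-def′ : ∀ k → φ m (k , q k) ≡ q k ℤ.* h (m ∸ k)
    φ-def′ k = φ-def m k (q k)

sumℤ-map-+ : ∀ (f : ℕ → ℤ) (g : ℕ → ℕ) xs → (∀ {k} → k ∈ xs → f k ≡ ℤ.+ g k) →
             sumℤ (map f xs) ≡ ℤ.+ sum (map g xs)
sumℤ-map-+ f g []       _  = refl
sumℤ-map-+ f g (x ∷ xs) eq = cong₂ ℤ._+_ (eq (here refl)) (sumℤ-map-+ f g xs (eq ∘ there))

G≡#withoutStrongFixedPoint : ∀ m → G m ≡ ℤ.+ #withoutStrongFixedPoint m
G≡#withoutStrongFixedPoint = <-rec _ step
  where
  +-minus : ∀ x y → x ℤ.+ y ℤ.- y ≡ x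
  +-minus = solve 2 (λ x y → x :+ y :- y := x) refl
  step : ∀ m → (∀ {k} → k < m → G k ≡ ℤ.+ #withoutStrongFixedPoint k) → G m ≡ ℤ.+ #withoutStrongFixedPoint m
  step m ih = begin
    G m                                ≡⟨ divPS-recurrence F onePlusXF m ⟩
    F m ℤ.- sumℤ (map term (upTo m))   ≡⟨ cong (λ t → F m ℤ.- t) (sumℤ-map-+ term _ (upTo m) (term≡ ∘ ∈-upTo⁻)) ⟩
    ℤ.+ (m !) ℤ.- ℤ.+ P                ≡⟨ cong (λ t → ℤ.+ t ℤ.- ℤ.+ P) (factorial-recurrence m) ⟩
    ℤ.+ a ℤ.+ ℤ.+ P ℤ.- ℤ.+ P          ≡⟨ +-minus (ℤ.+ a) (ℤ.+ P) ⟩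
    ℤ.+ a                              ∎
    where
    open ≡-Reasoning
    a P : ℕ
    a = #withoutStrongFixedPoint m
    P = #pieces m
    term : ℕ → ℤ
    term k = G k ℤ.* onePlusXF (m ∸ k)
    term≡ : ∀ {k} → k < m → term k ≡ ℤ.+ (#withoutStrongFixedPoint k * (m ∸ suc k) !)
    term≡ {k} k<m = begin
      G k ℤ.* onePlusXF (m ∸ k)                               ≡⟨ cong₂ ℤ._*_ (ih k<m) (cong onePlusXF (+-∸-assoc 1 k<m)) ⟩
      ℤ.+ #withoutStrongFixedPoint k ℤ.* ℤ.+ ((m ∸ suc k) !)  ≡⟨ ℤ.pos-* (#withoutStrongFixedPoint k) _ ⟨
      ℤ.+ (#withoutStrongFixedPoint k * (m ∸ suc k) !)        ∎

-- Occurrences of the mesh pattern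

pos-injective : ∀ {n} {x y : Fin n} → pos x ≡ pos y → x ≡ y
pos-injective = Fin.toℕ-injective ∘ suc-injective

InColumn : ∀ {n} → Fin n → Fin n → Fin n → Fin 3 → Set
InColumn {n} i j x a =
  bound (pos i) (pos j) (suc n) (inject₁ a) < pos x × pos x < bound (pos i) (pos j) (suc n) (suc a)

InRow : ∀ {n} → Vec ℕ n → Fin n → Fin n → Fin n → Fin 3 → Set
InRow {n} π i j x b =
  bound (lookup π i) (lookup π j) (suc n) (inject₁ b) < lookup π x ×
  lookup π x < bound (lookup π i) (lookup π j) (suc n) (suc b)

occupied⇒¬BoxEmpty : ∀ {n} {π : Vec ℕ n} {i j x a b} →
                     InColumn i j x a → InRow π i j x b → ¬ BoxEmpty π i j (a , b)
occupied⇒¬BoxEmpty (c₁ , c₂) (r₁ , r₂) empty = empty (_ , c₁ , c₂ , r₁ , r₂)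

interval-of : ∀ {p q hi v} → 0 < v → v < hi → v ≢ p → v ≢ q →
              ∃ λ a → bound p q hi (inject₁ a) < v × v < bound p q hi (suc a)
interval-of {p} {q} {v = v} 0<v v<hi v≢p v≢q with <-cmp v p
... | tri< v<p _ _ = 0F , 0<v , v<p
... | tri≈ _ v≡p _ = contradiction v≡p v≢p
... | tri> _ _ p<v with <-cmp v q
...   | tri< v<q _ _ = 1F , p<v , v<q
...   | tri≈ _ v≡q _ = contradiction v≡q v≢q
...   | tri> _ _ q<v = 2F , q<v , v<hi

R₀-complement : ∀ a b → (a , b) ∈ R₀ ⊎ (a , b) ≡ (1F , 1F) ⊎ (a , b) ≡ (2F , 2F)
R₀-complement 0F 0F = inj₁ (here refl)
R₀-complement 0F 1F = inj₁ (there (here refl))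
R₀-complement 0F 2F = inj₁ (there (there (here refl)))
R₀-complement 1F 0F = inj₁ (there (there (there (here refl))))
R₀-complement 1F 1F = inj₂ (inj₁ refl)
R₀-complement 1F 2F = inj₁ (there (there (there (there (here refl)))))
R₀-complement 2F 0F = inj₁ (there (there (there (there (there (here refl))))))
R₀-complement 2F 1F = inj₁ (there (there (there (there (there (there (here refl)))))))
R₀-complement 2F 2F = inj₂ (inj₂ refl)

point-in-unshaded-box : ∀ {n i j} (π : Vec ℕ n) (x : Fin n) → IsPerm π →
  (∀ {r} → r ∈ R₀ → BoxEmpty π i j r) → x ≢ i → x ≢ j →
  (InColumn i j x 1F × InRow π i j x 1F) ⊎ (InColumn i j x 2F × InRow π i j x 2F)
point-in-unshaded-box {n} {i} {j} π x (range , injective) empty x≢i x≢j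
  with a , column ← interval-of {pos i} {pos j} {suc n} (s≤s z≤n) (s≤s (Fin.toℕ<n x)) (x≢i ∘ pos-injective)
                                                                                     (x≢j ∘ pos-injective)
     | b , row ← interval-of {lookup π i} {lookup π j} {suc n} (proj₁ (range x)) (s≤s (proj₂ (range x)))
                             (x≢i ∘ injective x i) (x≢j ∘ injective x j)
  with R₀-complement a b
... | inj₁ shaded      = contradiction (empty shaded) (occupied⇒¬BoxEmpty {π = π} {a = a} {b} column row)
... | inj₂ (inj₁ refl) = inj₁ (column , row)
... | inj₂ (inj₂ refl) = inj₂ (column , row)

Contains12⇒ : ∀ {m} (π : Vec ℕ (suc m)) → IsPerm π → Contains12 R₀ π →
  lookup π zero ≡ 1 × HasStrongFixedPoint (Vec.map (_∸ 1) (Vec.tail π))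
Contains12⇒ π perm (zero , zero , () , _)
Contains12⇒ π perm (suc i , j , i<j , _ , empty)
  with point-in-unshaded-box π zero perm empty (λ ()) (λ { refl → case i<j of λ () })
... | inj₁ ((s≤s () , _) , _)
... | inj₂ ((s≤s () , _) , _)
Contains12⇒ {m} (x ∷ w) perm@(range , _) (zero , suc k , _ , x<wk , empty) = x≡1 , k , below , above
  where
  w⁻ : Vec ℕ m
  w⁻ = Vec.map (_∸ 1) w
  other : ∀ t → t ≢ k → (InColumn zero (suc k) (suc t) 1F × InRow (x ∷ w) zero (suc k) (suc t) 1F) ⊎
                         (InColumn zero (suc k) (suc t) 2F × InRow (x ∷ w) zero (suc k) (suc t) 2F)
  other t t≢k = point-in-unshaded-box (x ∷ w) (suc t) perm empty (λ ()) (t≢k ∘ Fin.suc-injective)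
  decrement-< : ∀ {s t} → lookup w s < lookup w t → lookup w⁻ s < lookup w⁻ t
  decrement-< {s} {t} ws<wt = subst₂ _<_ (sym (lookup-map s (_∸ 1) w)) (sym (lookup-map t (_∸ 1) w))
                                         (∸-monoˡ-< ws<wt (proj₁ (range (suc s))))
  x≡1 : x ≡ 1
  x≡1 with IsPerm-surjective (x ∷ w) perm (s≤s z≤n) (s≤s z≤n)
  ... | zero  , x≡1  = x≡1
  ... | suc t , wt≡1 = contradiction (subst (x <_) wt≡1 x<wt) (≤⇒≯ (proj₁ (range zero)))
    where
    x<wt : x < lookup w t
    x<wt with other t (λ { refl → <⇒≱ (subst (x <_) wt≡1 x<wk) (proj₁ (range zero)) })
    ... | inj₁ (_ , x<wt , _)  = x<wt
    ... | inj₂ (_ , wk<wt , _) = <-trans x<wk wk<wt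
  below : ∀ t → toℕ t < toℕ k → lookup w⁻ t < lookup w⁻ k
  below t t<k with other t (λ { refl → <-irrefl refl t<k })
  ... | inj₁ (_ , _ , wt<wk) = decrement-< wt<wk
  ... | inj₂ ((k<t , _) , _) = contradiction t<k (<-asym (≤-pred (≤-pred k<t)))
  above : ∀ t → toℕ k < toℕ t → lookup w⁻ k < lookup w⁻ t
  above t k<t with other t (λ { refl → <-irrefl refl k<t })
  ... | inj₁ ((_ , t<k) , _) = contradiction k<t (<-asym (≤-pred (≤-pred t<k)))
  ... | inj₂ (_ , wk<wt , _) = decrement-< wk<wt

Contains12⇐ : ∀ {m} (π : Vec ℕ (suc m)) → IsPerm π →
  lookup π zero ≡ 1 × HasStrongFixedPoint (Vec.map (_∸ 1) (Vec.tail π)) → Contains12 R₀ π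
Contains12⇐ {m} (x ∷ w) (range , injective) (refl , k , below , above) = zero , suc k , s≤s z≤n , 1<wk , empty
  where
  w⁻ : Vec ℕ m
  w⁻ = Vec.map (_∸ 1) w
  1<wk : 1 < lookup w k
  1<wk = ≤∧≢⇒< (proj₁ (range (suc k))) (λ eq → case injective zero (suc k) eq of λ ())
  decrement-≤ : ∀ {s t} → lookup w s < lookup w t → lookup w⁻ s ≤ lookup w⁻ t
  decrement-≤ {s} {t} ws<wt = subst₂ _≤_ (sym (lookup-map s (_∸ 1) w)) (sym (lookup-map t (_∸ 1) w))
                                         (∸-monoˡ-≤ 1 (<⇒≤ ws<wt))
  empty : ∀ {r} → r ∈ R₀ → BoxEmpty (1 ∷ w) zero (suc k) r
  empty (here refl)                                         (_ , _ , s≤s () , _)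
  empty (there (here refl))                                 (_ , _ , s≤s () , _)
  empty (there (there (here refl)))                         (_ , _ , s≤s () , _)
  empty (there (there (there (here refl))))                 (_ , _ , _ , 0<v , v<1) = ≤⇒≯ 0<v v<1
  empty (there (there (there (there (here refl)))))         (zero , s≤s () , _)
  empty (there (there (there (there (here refl)))))         (suc t , _ , s≤s (s≤s t<k) , wk<wt , _) =
    <⇒≱ (below t t<k) (decrement-≤ wk<wt)
  empty (there (there (there (there (there (here refl))))))  (_ , _ , _ , 0<v , v<1) = ≤⇒≯ 0<v v<1
  empty (there (there (there (there (there (there (here refl))))))) (zero , s≤s () , _)
  empty (there (there (there (there (there (there (here refl))))))) (suc t , s≤s (s≤s k<t) , _ , _ , wt<wk) =
    <⇒≱ (above t k<t) (decrement-≤ wt<wk)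

-- Counting the avoiders

OneThenStrongFixedPoint : List ℕ → Set
OneThenStrongFixedPoint []       = ⊥
OneThenStrongFixedPoint (x ∷ xs) = x ≡ 1 × HasStrongFixedPointₗ (map (_∸ 1) xs)

oneThenStrongFixedPoint? : Decidable OneThenStrongFixedPoint
oneThenStrongFixedPoint? []       = no λ ()
oneThenStrongFixedPoint? (x ∷ xs) = x ℕ.≟ 1 ×-dec hasStrongFixedPointₗ? (map (_∸ 1) xs)

Contains12⇔OneThenStrongFixedPoint : ∀ {m} (π : Vec ℕ (suc m)) → IsPerm π →
                                     Contains12 R₀ π ⇔ OneThenStrongFixedPoint (toList π)
Contains12⇔OneThenStrongFixedPoint (x ∷ w) perm = mk⇔
  (λ c → let x≡1 , p = Contains12⇒ (x ∷ w) perm c in x≡1 , subst HasStrongFixedPointₗ tail≡ (to p))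
  (λ (x≡1 , p) → Contains12⇐ (x ∷ w) perm (x≡1 , from (subst HasStrongFixedPointₗ (sym tail≡) p)))
  where
  open Equivalence (HasStrongFixedPoint⇔ₗ (Vec.map (_∸ 1) w))
  tail≡ : toList (Vec.map (_∸ 1) w) ≡ map (_∸ 1) (toList w)
  tail≡ = toList-map (_∸ 1) w

oneTo-suc : ∀ m → oneTo (suc m) ≡ 1 ∷ map suc (oneTo m)
oneTo-suc m = cong (1 ∷_) (sym (map-applyUpTo suc suc m))

increment-↭ : ∀ {m σ} → σ ↭ oneTo m → 1 ∷ map suc σ ↭ oneTo (suc m)
increment-↭ {m} {σ} p = subst (1 ∷ map suc σ ↭_) (sym (oneTo-suc m)) (prep 1 (map⁺ suc p))

increment-↭⁻ : ∀ {m xs} → 1 ∷ xs ↭ oneTo (suc m) → ∃ λ σ → xs ≡ map suc σ × σ ↭ oneTo m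
increment-↭⁻ {m} {xs} p =
  let σ , xs≡ , oneTo↭σ = ↭-map-inv suc (↭-sym (drop-∷ (subst (1 ∷ xs ↭_) (oneTo-suc m) p)))
  in σ , xs≡ , ↭-sym oneTo↭σ

decrement-increment : ∀ σ → map (_∸ 1) (map suc σ) ≡ σ
decrement-increment σ = trans (sym (map-∘ σ)) (map-id σ)

avoiders containing : ℕ → List (List ℕ)
avoiders   m = filter (∁? oneThenStrongFixedPoint?) (perms (suc m))
containing m = filter oneThenStrongFixedPoint? (perms (suc m))

length-containing : ∀ m → length (containing m) ≡ length (withStrongFixedPoint m)
length-containing m = length-bijection (λ σ → 1 ∷ map suc σ)
  (Unique.filter⁺ oneThenStrongFixedPoint? (Unique-perms (suc m))) (Unique.filter⁺ hasStrongFixedPointₗ? (Unique-perms m))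
  (λ _ _ eq → map-injective suc-injective (∷-injectiveʳ eq)) into onto
  where
  into : ∀ {σ} → σ ∈ withStrongFixedPoint m → 1 ∷ map suc σ ∈ containing m
  into {σ} σ∈ = let σ∈perms , p = ∈-filter⁻ hasStrongFixedPointₗ? σ∈ in
    ∈-filter⁺ oneThenStrongFixedPoint? (perms-complete (suc m) (increment-↭ (perms-sound m σ∈perms)))
      (refl , subst HasStrongFixedPointₗ (sym (decrement-increment σ)) p)
  onto′ : ∀ {π} → π ↭ oneTo (suc m) → OneThenStrongFixedPoint π →
          ∃ λ σ → σ ∈ withStrongFixedPoint m × 1 ∷ map suc σ ≡ π
  onto′ {1 ∷ xs} p (refl , q) with σ , refl , σ↭ ← increment-↭⁻ p =
    σ , ∈-filter⁺ hasStrongFixedPointₗ? (perms-complete m σ↭) (subst HasStrongFixedPointₗ (decrement-increment σ) q) ,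
    refl
  onto : ∀ {π} → π ∈ containing m → ∃ λ σ → σ ∈ withStrongFixedPoint m × 1 ∷ map suc σ ≡ π
  onto π∈ = let π∈perms , q = ∈-filter⁻ oneThenStrongFixedPoint? {xs = perms (suc m)} π∈ in
    onto′ (perms-sound (suc m) π∈perms) q

avoiders-enumerate : ∀ m → NumAvoiders R₀ (suc m) (length (avoiders m))
avoiders-enumerate m = map (toVec n) (avoiders m) , unique , sound , complete , length-map (toVec n) (avoiders m)
  where
  n : ℕ
  n = suc m
  member : ∀ {σ} → σ ∈ avoiders m → σ ↭ oneTo n × ¬ OneThenStrongFixedPoint σ
  member σ∈ = let σ∈perms , ¬q = ∈-filter⁻ (∁? oneThenStrongFixedPoint?) {xs = perms n} σ∈ in
    perms-sound n σ∈perms , ¬q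
  toList-toVec-member : ∀ {σ} → σ ∈ avoiders m → toList (toVec n σ) ≡ σ
  toList-toVec-member {σ} σ∈ = toList-toVec σ (length-↭-oneTo (proj₁ (member σ∈)))
  unique : Unique (map (toVec n) (avoiders m))
  unique = Unique-map⁺-local (toVec n)
    (λ σ∈ τ∈ eq → trans (sym (toList-toVec-member σ∈)) (trans (cong toList eq) (toList-toVec-member τ∈)))
    (Unique.filter⁺ (∁? oneThenStrongFixedPoint?) (Unique-perms n))
  sound : All (λ π → IsPerm π × ¬ Contains12 R₀ π) (map (toVec n) (avoiders m))
  sound = All.map⁺ (All.tabulate λ {σ} σ∈ →
    let σ↭ , ¬q = member σ∈
        eq = toList-toVec-member σ∈
        perm = Equivalence.from (IsPerm⇔↭ (toVec n σ)) (subst (_↭ oneTo n) (sym eq) σ↭)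
    in perm , ¬q ∘ subst OneThenStrongFixedPoint eq ∘ Equivalence.to (Contains12⇔OneThenStrongFixedPoint (toVec n σ) perm))
  complete : ∀ π → IsPerm π → ¬ Contains12 R₀ π → π ∈ map (toVec n) (avoiders m)
  complete π perm ¬contains = subst (_∈ map (toVec n) (avoiders m)) (toVec-toList π) (∈-map⁺ (toVec n) π∈)
    where
    π∈ : toList π ∈ avoiders m
    π∈ = ∈-filter⁺ (∁? oneThenStrongFixedPoint?) (perms-complete n (Equivalence.to (IsPerm⇔↭ π) perm))
                   (¬contains ∘ Equivalence.from (Contains12⇔OneThenStrongFixedPoint π perm))

avoiders-formula : ∀ m → ℤ.+ length (avoiders m) ≡ (ℤ.+ (suc m !) ℤ.- ℤ.+ (m !)) ℤ.+ G m
avoiders-formula m = begin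
  ℤ.+ N                                    ≡⟨ rearrange (ℤ.+ N) (ℤ.+ c) (ℤ.+ a) ⟩
  (ℤ.+ (c + N) ℤ.- ℤ.+ (c + a)) ℤ.+ ℤ.+ a  ≡⟨ cong₂ (λ s t → (ℤ.+ s ℤ.- ℤ.+ t) ℤ.+ ℤ.+ a) partition-suc partition ⟩
  D ℤ.+ ℤ.+ a                              ≡⟨ cong (λ t → D ℤ.+ t) (G≡#withoutStrongFixedPoint m) ⟨
  D ℤ.+ G m                                ∎
  where
  open ≡-Reasoning
  D : ℤ
  D = ℤ.+ (suc m !) ℤ.- ℤ.+ (m !)
  N c a : ℕ
  N = length (avoiders m)
  c = length (withStrongFixedPoint m)
  a = #withoutStrongFixedPoint m
  partition-suc : c + N ≡ suc m !
  partition-suc = trans (cong (_+ N) (sym (length-containing m)))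
                    (trans (length-filter-∁ oneThenStrongFixedPoint? (perms (suc m))) (length-perms (suc m)))
  partition : c + a ≡ m !
  partition = trans (length-filter-∁ hasStrongFixedPointₗ? (perms m)) (length-perms m)
  rearrange : ∀ N c a → N ≡ (c ℤ.+ N ℤ.- (c ℤ.+ a)) ℤ.+ a
  rearrange = solve 3 (λ N c a → N := (c :+ N :- (c :+ a)) :+ a) refl

proposition4p12 :
  (∀ (m : ℕ) (π : Vec ℕ (suc m)) → IsPerm π →
     (Contains12 R₀ π ⇔
       (lookup π zero ≡ 1 × HasStrongFixedPoint (Vec.map (λ x → x ∸ 1) (Vec.tail π))))) ×
  (∀ (m : ℕ) → Σ ℕ λ N → NumAvoiders R₀ (suc m) N ×
     (ℤ.+ N ≡ (ℤ.+ (suc m !) ℤ.- ℤ.+ (m !)) ℤ.+ G m))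
proposition4p12 =
  (λ m π perm → mk⇔ (Contains12⇒ π perm) (Contains12⇐ π perm)) ,
  (λ m → length (avoiders m) , avoiders-enumerate m , avoiders-formula m)
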